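{- Let $p$ be an odd prime, let $m,n$ be integers with $m\ge n+2\ge 3$, and let $\lambda\in\mathbb{Z}_{p^m}^*$ have multiplicative order $p^{n+1}$. Let $\mathcal{G}=\langle x,y,z\mid x^{p^{m-1}}=y^{p^n}=z^p=1,\ y^{ -1}xy=x^{\lambda},\ [z,x]=[z,y]=1\rangle$ and $S=\{x,xz,xz^2,\dots,xz^{p-1},y\}$. Then $\mathrm{MP}_{p^m,p^n,p^{m-1},\lambda}\cong\mathrm{Cay}(\mathcal{G},S\cup S^{ -1})$.
   Context: The Cayley graph $\mathrm{Cay}(G,T)$ ($T\subseteq G\setminus\{1\}$ inverse-closed) has vertex set $G$ and edges $\{g,tg\}$, $g\in G$, $t\in T$. With $H=\langle h\rangle\cong C_{p^m}$, for $i\in\mathbb{Z}_{p^n}$: $V_i=\{(h^j,i): j\in\mathbb{Z}_{p^m}\}$, $E_i=\{\{(h^j,i),(h^{j+kp^{m-1}+\lambda^i},i)\},\{(h^j,i),(h^{j-kp^{m-1}-\lambda^i},i)\}: k\in\mathbb{Z}_p, j\in\mathbb{Z}_{p^m}\}$, $E_{i,i+1}=\{\{(h^j,i),(h^j,i+1)\}: j\in\mathbb{Z}_{p^m}\}$ (layer indices mod $p^n$); $\mathrm{MP}_{p^m,p^n,p^{m-1},\lambda}$ has vertex set $\bigcup_i V_i$ and edge set $\bigcup_i(E_i\cup E_{i,i+1})$. -}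

module Defs where

open import Data.Nat using (ℕ; zero; suc; _+_; _*_; _∸_; _^_; _<_; _≤_; NonZero)
open import Data.Nat.DivMod using (_%_)
open import Data.Fin using (Fin; toℕ)
open import Data.Product using (Σ; ∃; _×_; _,_)
open import Data.Sum using (_⊎_)
open import Relation.Binary.PropositionalEquality using (_≡_)
open import Relation.Nullary using (¬_)

HasMultOrder : (λ' N d : ℕ) .{{_ : NonZero N}} → Set
HasMultOrder λ' N d =
  (0 < d) × ((λ' ^ d) % N ≡ 1 % N) ×
  (∀ e → 0 < e → e < d → ¬ ((λ' ^ e) % N ≡ 1 % N))

-- The graph MP_{p^m, p^n, p^{m-1}, λ}.
-- Vertex (h^j, i) is represented by (j , i) with j ∈ Z_{p^m}, i ∈ Z_{p^n}.

MPVertex : (p m n : ℕ) → Set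
MPVertex p m n = Fin (p ^ m) × Fin (p ^ n)

-- adjacency (edge set ⋃_i (E_i ∪ E_{i,i+1}), read as an undirected graph)
MPAdj : (p m n λ' : ℕ) .{{_ : NonZero (p ^ m)}} .{{_ : NonZero (p ^ n)}} →
        MPVertex p m n → MPVertex p m n → Set
MPAdj p m n λ' (j , i) (j' , i') =
  -- edges of E_i : {(h^a,i), (h^{a ± (k p^{m-1} + λ^i)},i)}
  ( toℕ i ≡ toℕ i' ×
    Σ ℕ (λ k → k < p ×
      ( toℕ j' ≡ (toℕ j + (k * p ^ (m ∸ 1) + λ' ^ toℕ i)) % (p ^ m)
      ⊎ toℕ j ≡ (toℕ j' + (k * p ^ (m ∸ 1) + λ' ^ toℕ i)) % (p ^ m))))
  ⊎
  ( toℕ j ≡ toℕ j' ×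
    ( toℕ i' ≡ (toℕ i + 1) % (p ^ n)
    ⊎ toℕ i ≡ (toℕ i' + 1) % (p ^ n)))

-- The finitely presented group
--   G = ⟨ x, y, z | x^{p^{m-1}} = y^{p^n} = z^p = 1, y⁻¹xy = x^λ,
--                   [z,x] = [z,y] = 1 ⟩
-- realised as group words modulo the congruence generated by the
-- group axioms and the defining relations (a setoid).

data Gen : Set where
  gx gy gz : Gen

data Word : Set where
  gen  : Gen → Word
  one  : Word
  _·_  : Word → Word → Word
  inv  : Word → Word

infixl 7 _·_

pow : Word → ℕ → Word
pow w zero    = one
pow w (suc k) = w · pow w k

X Y Z : Word
X = gen gx
Y = gen gy
Z = gen gz

comm : Word → Word → Word
comm a b = inv a · inv b · a · b

module _ (p m n λ' : ℕ) where
  data GEq : Word → Word → Set where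
    ≈refl  : ∀ {a} → GEq a a
    ≈sym   : ∀ {a b} → GEq a b → GEq b a
    ≈trans : ∀ {a b c} → GEq a b → GEq b c → GEq a c
    ·-cong   : ∀ {a b c d} → GEq a b → GEq c d → GEq (a · c) (b · d)
    inv-cong : ∀ {a b} → GEq a b → GEq (inv a) (inv b)
    assoc  : ∀ a b c → GEq ((a · b) · c) (a · (b · c))
    idˡ    : ∀ a → GEq (one · a) a
    idʳ    : ∀ a → GEq (a · one) a
    invˡ   : ∀ a → GEq (inv a · a) one
    invʳ   : ∀ a → GEq (a · inv a) one
    relX   : GEq (pow X (p ^ (m ∸ 1))) one
    relY   : GEq (pow Y (p ^ n)) one
    relZ   : GEq (pow Z p) one
    relYX  : GEq (inv Y · X · Y) (pow X λ')
    relZX  : GEq (comm Z X) one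
    relZY  : GEq (comm Z Y) one

_≈⟨_,_,_,_⟩_ : Word → (p m n λ' : ℕ) → Word → Set
a ≈⟨ p , m , n , λ' ⟩ b = GEq p m n λ' a b

InS : (p : ℕ) → Word → Set
InS p s = Σ ℕ (λ k → k < p × s ≡ X · pow Z k) ⊎ s ≡ Y

CayAdj : (p m n λ' : ℕ) → Word → Word → Set
CayAdj p m n λ' g g' =
  Σ Word (λ s → InS p s ×
    (g' ≈⟨ p , m , n , λ' ⟩ (s · g) ⊎ g' ≈⟨ p , m , n , λ' ⟩ (inv s · g)))

-- Write m = m₁ + 1.  Elements of G are identified with coordinates
-- (b , a , c) ∈ ℤ_{p^n} × ℤ_{p^m₁} × ℤ_p standing for y^b x^a z^c:
--   * G acts on coordinates (x adds λ^b to a, y adds 1 to b, z adds 1 to c).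
--     The action is well defined as soon as λ^(p^n) ≡ 1 (mod p^m₁), and the
--     defining relations hold for it, so equal words act equally (`sound`).
--   * Left multiplication transforms normal forms y^b x^a z^c exactly as the
--     action transforms coordinates (`act-nf-left`); hence every word equals
--     the normal form of its coordinates, and two words are equal iff their
--     coordinates agree.
-- The vertex (h^j, i) is sent to y^i x^(j mod p^m₁) z^(j div p^m₁); this is a
-- bijection onto G under which the arcs of MP inside a layer (between layers)
-- are exactly the arcs of the Cayley digraph labelled x z^k (labelled y).
-- The hypotheses of the paper are only used to derive λ^(p^n) ≡ 1 (mod p^m₁):
-- λ^(p^(n+1)) ≡ 1 (mod p^m), and for an odd prime p a p-th root of unity
-- modulo p^(k+1) is ≡ 1 modulo p^k (Fermat and the binomial theorem).

module Submission where

open import Defs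
open import Data.Nat using (ℕ; zero; suc; _+_; _*_; _∸_; _^_; _<_; _≤_; NonZero; z≤n; s≤s; nonTrivial⇒n>1; z<s)
open import Data.Nat.Properties
open import Data.Nat.DivMod
open import Data.Nat.Divisibility
open import Data.Nat.Combinatorics using (_C_; nC1≡n; nCn≡1; k>n⇒nCk≡0; nCk+nC[k+1]≡[n+1]C[k+1])
open import Data.Nat.Coprimality using (Coprime)
open import Data.Nat.Primality using (Prime; euclidsLemma; ¬prime[0]; ¬prime[1]; prime⇒nonZero; prime⇒nonTrivial)
open import Data.Sum using (_⊎_; inj₁; inj₂)
open import Data.Empty using (⊥-elim)
open import Relation.Nullary using (¬_; contradiction)
open import Function.Bundles using (_⇔_; mk⇔; Equivalence)
import Function.Properties.Equivalence as ⇔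
open import Data.Sum.Function.Propositional using (_⊎-⇔_)
open import Data.Product using (Σ; ∃-syntax; _×_; _,_)
open import Data.Product.Relation.Binary.Pointwise.NonDependent using (×-setoid)
open import Relation.Binary.PropositionalEquality using (_≡_; refl; sym; trans; cong; cong₂; subst; module ≡-Reasoning)
open import Relation.Binary.Bundles using (Setoid)
import Relation.Binary.Reasoning.Setoid as SetoidReasoning
open import Level using (0ℓ)
open import Algebra.Bundles using (Group)
import Algebra.Properties.Group as GroupProperties
open import Data.Nat.Tactic.RingSolver using (solve-∀)
open import Data.Fin using (Fin; toℕ; fromℕ<)
open import Data.Fin.Properties using (toℕ-injective; toℕ<n; toℕ-fromℕ<)

-- Congruence modulo N.  It is a record rather than the bare equation
-- a % N ≡ b % N so that a and b can be inferred from a proof of it.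
infix 4 _≡[_]_
record _≡[_]_ (a N b : ℕ) .{{_ : NonZero N}} : Set where
  constructor mod
  field residue : a % N ≡ b % N

module _ {N : ℕ} .{{_ : NonZero N}} where

  mod-refl : ∀ {a} → a ≡[ N ] a
  mod-refl = mod refl

  mod-sym : ∀ {a b} → a ≡[ N ] b → b ≡[ N ] a
  mod-sym (mod e) = mod (sym e)

  mod-trans : ∀ {a b c} → a ≡[ N ] b → b ≡[ N ] c → a ≡[ N ] c
  mod-trans (mod e) (mod f) = mod (trans e f)

  ≡⇒mod : ∀ {a b} → a ≡ b → a ≡[ N ] b
  ≡⇒mod refl = mod-refl

mod-setoid : (N : ℕ) .{{_ : NonZero N}} → Setoid 0ℓ 0ℓ
mod-setoid N = record
  { Carrier = ℕ
  ; _≈_ = _≡[ N ]_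
  ; isEquivalence = record { refl = mod-refl ; sym = mod-sym ; trans = mod-trans }
  }

module ModReasoning (N : ℕ) .{{_ : NonZero N}} = SetoidReasoning (mod-setoid N)

module _ {N : ℕ} .{{_ : NonZero N}} where

  +-mod : ∀ {a a' b b'} → a ≡[ N ] a' → b ≡[ N ] b' → a + b ≡[ N ] a' + b'
  +-mod {a} {a'} {b} {b'} (mod e) (mod f) = mod (begin
    (a + b) % N              ≡⟨ %-distribˡ-+ a b N ⟩
    (a % N + b % N) % N      ≡⟨ cong₂ (λ u v → (u + v) % N) e f ⟩
    (a' % N + b' % N) % N    ≡⟨ %-distribˡ-+ a' b' N ⟨
    (a' + b') % N            ∎)
    where open ≡-Reasoning

  *-mod : ∀ {a a' b b'} → a ≡[ N ] a' → b ≡[ N ] b' → a * b ≡[ N ] a' * b'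
  *-mod {a} {a'} {b} {b'} (mod e) (mod f) = mod (begin
    (a * b) % N              ≡⟨ %-distribˡ-* a b N ⟩
    (a % N * (b % N)) % N    ≡⟨ cong₂ (λ u v → (u * v) % N) e f ⟩
    (a' % N * (b' % N)) % N  ≡⟨ %-distribˡ-* a' b' N ⟨
    (a' * b') % N            ∎)
    where open ≡-Reasoning

  ^-mod : ∀ {a b} k → a ≡[ N ] b → a ^ k ≡[ N ] b ^ k
  ^-mod zero    e = mod-refl
  ^-mod (suc k) e = *-mod e (^-mod k e)

  %-mod : ∀ a → a % N ≡[ N ] a
  %-mod a = mod (m%n%n≡m%n a N)

  +-multiple-mod : ∀ a k → a + k * N ≡[ N ] a
  +-multiple-mod a k = mod ([m+kn]%n≡m%n a k N)

  +-inverse-mod : ∀ t → t + (N ∸ 1) * t ≡[ N ] 0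
  +-inverse-mod t = mod-trans (≡⇒mod (t+[N-1]t≡tN N t)) (+-multiple-mod 0 t)
    where
    t+[N-1]t≡tN : ∀ N .{{_ : NonZero N}} t → t + (N ∸ 1) * t ≡ 0 + t * N
    t+[N-1]t≡tN (suc k) t = *-comm (suc k) t

  translate-inverseˡ : ∀ t a → t + ((N ∸ 1) * t + a) ≡[ N ] a
  translate-inverseˡ t a = begin
    t + ((N ∸ 1) * t + a)  ≡⟨ +-assoc t _ a ⟨
    t + (N ∸ 1) * t + a    ≈⟨ +-mod (+-inverse-mod t) mod-refl ⟩
    a                      ∎
    where open ModReasoning N

  translate-inverseʳ : ∀ t a → (N ∸ 1) * t + (t + a) ≡[ N ] a
  translate-inverseʳ t a = begin
    (N ∸ 1) * t + (t + a)  ≡⟨ +-assoc ((N ∸ 1) * t) t a ⟨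
    (N ∸ 1) * t + t + a    ≡⟨ cong (_+ a) (+-comm ((N ∸ 1) * t) t) ⟩
    t + (N ∸ 1) * t + a    ≈⟨ +-mod (+-inverse-mod t) mod-refl ⟩
    a                      ∎
    where open ModReasoning N

  mod⇒≡ : ∀ {a b} → a < N → b < N → a ≡[ N ] b → a ≡ b
  mod⇒≡ a<N b<N (mod e) = trans (sym (m<n⇒m%n≡m a<N)) (trans e (m<n⇒m%n≡m b<N))

  mod⇒≡% : ∀ {x y} → x < N → x ≡[ N ] y → x ≡ y % N
  mod⇒≡% {x} {y} x<N x≡y = mod⇒≡ x<N (m%n<n y N) (mod-trans x≡y (mod-sym (%-mod y)))

  ≡%⇒mod : ∀ {x y} → x ≡ y % N → x ≡[ N ] y
  ≡%⇒mod {x} {y} x≡y%N = mod-trans (≡⇒mod x≡y%N) (%-mod y)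

  mod-∣ : ∀ {d a b} .{{_ : NonZero d}} → d ∣ N → a ≡[ N ] b → a ≡[ d ] b
  mod-∣ {d} {a} {b} d∣N (mod e) = mod (begin
    a % d        ≡⟨ m∣n⇒o%n%m≡o%m d N a d∣N ⟨
    a % N % d    ≡⟨ cong (_% d) e ⟩
    b % N % d    ≡⟨ m∣n⇒o%n%m≡o%m d N b d∣N ⟩
    b % d        ∎)
    where open ≡-Reasoning

  +-mod-self⇒∣ : ∀ a d → a + d ≡[ N ] a → N ∣ d
  +-mod-self⇒∣ a d (mod e) = ∣m+n∣m⇒∣n N∣[a/N]N+d (n∣m*n (a / N))
    where
    open ≡-Reasoning
    N∣[a/N]N+d : N ∣ a / N * N + d
    N∣[a/N]N+d = divides ((a + d) / N) (+-cancelˡ-≡ (a % N) _ _ (begin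
      a % N + (a / N * N + d)        ≡⟨ +-assoc (a % N) _ d ⟨
      a % N + a / N * N + d          ≡⟨ cong (_+ d) (m≡m%n+[m/n]*n a N) ⟨
      a + d                          ≡⟨ m≡m%n+[m/n]*n (a + d) N ⟩
      (a + d) % N + (a + d) / N * N  ≡⟨ cong (_+ (a + d) / N * N) e ⟩
      a % N + (a + d) / N * N        ∎))

  ∣⇒+-mod-self : ∀ a {d} → N ∣ d → a + d ≡[ N ] a
  ∣⇒+-mod-self a (divides k refl) = +-multiple-mod a k

  residue-difference : ∀ x y → ∃[ k ] k < N × x ≡[ N ] k + y
  residue-difference x y = k , m%n<n _ N , mod-sym k+y≡x
    where
    k = (x + (N ∸ 1) * y) % N
    k+y≡x : k + y ≡[ N ] x
    k+y≡x = begin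
      k + y                   ≈⟨ +-mod (%-mod (x + (N ∸ 1) * y)) mod-refl ⟩
      x + (N ∸ 1) * y + y     ≡⟨ +-assoc x _ y ⟩
      x + ((N ∸ 1) * y + y)   ≡⟨ cong (x +_) (+-comm ((N ∸ 1) * y) y) ⟩
      x + (y + (N ∸ 1) * y)   ≈⟨ +-mod (mod-refl {a = x}) (+-inverse-mod y) ⟩
      x + 0                   ≡⟨ +-identityʳ x ⟩
      x                       ∎
      where open ModReasoning N

module _ {M N : ℕ} .{{_ : NonZero M}} .{{_ : NonZero N}} where
  private instance
    M*N≢0 : NonZero (M * N)
    M*N≢0 = m*n≢0 M N

  *-scale-mod : ∀ {a b} → a ≡[ M ] b → a * N ≡[ M * N ] b * N
  *-scale-mod {a} {b} (mod e) = mod (begin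
    a * N % (M * N)  ≡⟨ m%n*o≡m*o%[n*o] a M N ⟨
    a % M * N        ≡⟨ cong (_* N) e ⟩
    b % M * N        ≡⟨ m%n*o≡m*o%[n*o] b M N ⟩
    b * N % (M * N)  ∎)
    where open ≡-Reasoning

  refine⇔ : ∀ {x y t} → x < M * N →
    (∃[ k ] k < M × x ≡ (y + (k * N + t)) % (M * N)) ⇔ x ≡[ N ] t + y
  refine⇔ {x} {y} {t} x<MN = mk⇔ coarsen refine
    where
    regroup : ∀ y k N t → y + (k * N + t) ≡ t + y + k * N
    regroup = solve-∀

    coarsen : (∃[ k ] k < M × x ≡ (y + (k * N + t)) % (M * N)) → x ≡[ N ] t + y
    coarsen (k , _ , x≡) = mod-trans (mod-∣ (n∣m*n M) (≡%⇒mod (trans x≡ (cong (_% (M * N)) (regroup y k N t)))))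
                                     (+-multiple-mod (t + y) k)

    refine : x ≡[ N ] t + y → ∃[ k ] k < M × x ≡ (y + (k * N + t)) % (M * N)
    refine (mod x%≡) with residue-difference {M} (x / N) ((t + y) / N)
    ... | k , k<M , high≡ = k , k<M , mod⇒≡% x<MN (begin
      x                                        ≡⟨ m≡m%n+[m/n]*n x N ⟩
      x % N + x / N * N                        ≡⟨ cong (_+ x / N * N) x%≡ ⟩
      (t + y) % N + x / N * N                  ≈⟨ +-mod (mod-refl {a = (t + y) % N}) (*-scale-mod high≡) ⟩
      (t + y) % N + (k + (t + y) / N) * N      ≡⟨ digits k ((t + y) % N) ((t + y) / N) N ⟩
      (t + y) % N + (t + y) / N * N + k * N    ≡⟨ cong (_+ k * N) (m≡m%n+[m/n]*n (t + y) N) ⟨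
      t + y + k * N                            ≡⟨ regroup y k N t ⟨
      y + (k * N + t)                          ∎)
      where
      open ModReasoning (M * N)
      digits : ∀ k r q N → r + (k + q) * N ≡ r + q * N + k * N
      digits = solve-∀

binomialSum : ℕ → ℕ → ℕ → ℕ
binomialSum n x zero    = 0
binomialSum n x (suc k) = binomialSum n x k + (n C k) * x ^ k

binomialSum-pascal : ∀ n x k →
  binomialSum (suc n) x (suc k) ≡ binomialSum n x (suc k) + x * binomialSum n x k
binomialSum-pascal n x zero    = cong (1 +_) (sym (*-zeroʳ x))
binomialSum-pascal n x (suc k) = begin
  binomialSum (suc n) x (suc k) + (suc n C suc k) * x ^ suc k
    ≡⟨ cong₂ (λ s c → s + c * x ^ suc k) (binomialSum-pascal n x k) (sym (nCk+nC[k+1]≡[n+1]C[k+1] n k)) ⟩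
  (S₁ + x * S₀) + ((n C k) + (n C suc k)) * (x * x ^ k)
    ≡⟨ regroup S₁ S₀ (n C k) (n C suc k) x (x ^ k) ⟩
  (S₁ + (n C suc k) * (x * x ^ k)) + x * (S₀ + (n C k) * x ^ k) ∎
  where
  open ≡-Reasoning
  S₀ = binomialSum n x k
  S₁ = binomialSum n x (suc k)
  regroup : ∀ a b c d x y → (a + x * b) + (c + d) * (x * y) ≡ (a + d * (x * y)) + x * (b + c * y)
  regroup = solve-∀

binomial-theorem : ∀ n x → (1 + x) ^ n ≡ binomialSum n x (suc n)
binomial-theorem zero    x = refl
binomial-theorem (suc n) x = begin
  (1 + x) * (1 + x) ^ n                   ≡⟨ cong ((1 + x) *_) (binomial-theorem n x) ⟩
  S + x * S                               ≡⟨ cong (_+ x * S) last-term-vanishes ⟨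
  binomialSum n x (2 + n) + x * S         ≡⟨ binomialSum-pascal n x (suc n) ⟨
  binomialSum (suc n) x (2 + n)           ∎
  where
  open ≡-Reasoning
  S = binomialSum n x (suc n)
  last-term-vanishes : binomialSum n x (2 + n) ≡ S
  last-term-vanishes = begin
    S + (n C suc n) * x ^ suc n  ≡⟨ cong (λ c → S + c * x ^ suc n) (k>n⇒nCk≡0 (n<1+n n)) ⟩
    S + 0                      ≡⟨ +-identityʳ S ⟩
    S                          ∎

binomial-absorption : ∀ n k → suc k * (suc n C suc k) ≡ suc n * (n C k)
binomial-absorption zero    zero    = refl
binomial-absorption zero    (suc k) = *-zeroʳ (2 + k)
binomial-absorption (suc n) zero    = begin
  1 * ((2 + n) C 1)  ≡⟨ *-identityˡ _ ⟩
  (2 + n) C 1      ≡⟨ nC1≡n (2 + n) ⟩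
  2 + n            ≡⟨ *-identityʳ (2 + n) ⟨
  (2 + n) * 1      ∎
  where open ≡-Reasoning
binomial-absorption (suc n) (suc k) = begin
  (2 + k) * ((2 + n) C (2 + k))         ≡⟨ cong ((2 + k) *_) (nCk+nC[k+1]≡[n+1]C[k+1] (suc n) (suc k)) ⟨
  (2 + k) * (B₁ + B₂)                   ≡⟨ *-distribˡ-+ (2 + k) B₁ B₂ ⟩
  (B₁ + (1 + k) * B₁) + (2 + k) * B₂
    ≡⟨ cong₂ (λ u v → (B₁ + u) + v) (binomial-absorption n k) (binomial-absorption n (suc k)) ⟩
  (B₁ + (1 + n) * (n C k)) + (1 + n) * (n C suc k)  ≡⟨ regroup B₁ (1 + n) (n C k) (n C suc k) ⟩
  B₁ + (1 + n) * ((n C k) + (n C suc k)) ≡⟨ cong (λ u → B₁ + (1 + n) * u) (nCk+nC[k+1]≡[n+1]C[k+1] n k) ⟩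
  (2 + n) * B₁                          ∎
  where
  open ≡-Reasoning
  B₁ = suc n C suc k
  B₂ = suc n C (2 + k)
  regroup : ∀ b m c d → (b + m * c) + m * d ≡ b + m * (c + d)
  regroup = solve-∀

prime∣binomial : ∀ {p k} → Prime p → 0 < k → k < p → p ∣ p C k
prime∣binomial {zero}  p-prime = ⊥-elim (¬prime[0] p-prime)
prime∣binomial {suc n} {suc k} p-prime 0<k k<p
  with euclidsLemma (suc k) (suc n C suc k) p-prime (divides (n C k) absorption)
  where
  absorption : suc k * (suc n C suc k) ≡ (n C k) * suc n
  absorption = trans (binomial-absorption n k) (*-comm (suc n) (n C k))
... | inj₁ p∣k   = ⊥-elim (<⇒≱ k<p (∣⇒≤ p∣k))
... | inj₂ p∣pCk = p∣pCk

binomialSum-prime : ∀ {p} → Prime p → ∀ x j → 2 + j ≤ p →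
  ∃[ M ] binomialSum p x (2 + j) ≡ 1 + p * x + p * (x * x * M)
binomialSum-prime {p} p-prime x zero    _ = 0 , (begin
  1 + (p C 1) * (x * 1)        ≡⟨ cong (λ c → 1 + c * (x * 1)) (nC1≡n p) ⟩
  1 + p * (x * 1)              ≡⟨ tidy p x ⟩
  1 + p * x + p * (x * x * 0)  ∎)
  where
  open ≡-Reasoning
  tidy : ∀ p x → 1 + p * (x * 1) ≡ 1 + p * x + p * (x * x * 0)
  tidy = solve-∀
binomialSum-prime {p} p-prime x (suc j) 3+j≤p
  with binomialSum-prime p-prime x j (≤-trans (n≤1+n _) 3+j≤p) | prime∣binomial p-prime (s≤s z≤n) 3+j≤p
... | M , sum≡ | divides q pCk≡qp = M + q * x ^ j , (begin
  binomialSum p x (2 + j) + (p C (2 + j)) * x ^ (2 + j)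
    ≡⟨ cong₂ (λ s c → s + c * x ^ (2 + j)) sum≡ pCk≡qp ⟩
  1 + p * x + p * (x * x * M) + q * p * (x * (x * x ^ j))
    ≡⟨ regroup p x M q (x ^ j) ⟩
  1 + p * x + p * (x * x * (M + q * x ^ j)) ∎)
  where
  open ≡-Reasoning
  regroup : ∀ p x M q y →
    1 + p * x + p * (x * x * M) + q * p * (x * (x * y)) ≡ 1 + p * x + p * (x * x * (M + q * y))
  regroup = solve-∀

prime-binomial : ∀ {p} → Prime p → ∀ x →
  ∃[ M ] (1 + x) ^ p ≡ 1 + p * x + p * (x * x * M) + x ^ p
prime-binomial {zero}              p-prime = ⊥-elim (¬prime[0] p-prime)
prime-binomial {suc zero}          p-prime = ⊥-elim (¬prime[1] p-prime)
prime-binomial {p@(suc (suc r))}   p-prime x with binomialSum-prime p-prime x r ≤-refl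
... | M , sum≡ = M , (begin
  (1 + x) ^ p                                  ≡⟨ binomial-theorem p x ⟩
  binomialSum p x p + (p C p) * x ^ p          ≡⟨ cong₂ (λ s c → s + c * x ^ p) sum≡ (nCn≡1 p) ⟩
  1 + p * x + p * (x * x * M) + 1 * x ^ p      ≡⟨ cong (1 + p * x + p * (x * x * M) +_) (*-identityˡ (x ^ p)) ⟩
  1 + p * x + p * (x * x * M) + x ^ p          ∎)
  where open ≡-Reasoning

module PrimePowers {p : ℕ} (p-prime : Prime p) where

  instance
    p≢0 : NonZero p
    p≢0 = prime⇒nonZero p-prime

  infix 4 _≡[p^_]_
  _≡[p^_]_ : ℕ → ℕ → ℕ → Set
  a ≡[p^ k ] b = _≡[_]_ a (p ^ k) b {{m^n≢0 p k}}

  1<p : 1 < p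
  1<p = nonTrivial⇒n>1 p {{prime⇒nonTrivial p-prime}}

  0^p≡0 : 0 ^ p ≡ 0
  0^p≡0 = zero-power p
    where
    zero-power : ∀ n .{{_ : NonZero n}} → 0 ^ n ≡ 0
    zero-power (suc n) = refl

  -- Fermat's little theorem, by induction on x using (1 + x)^p ≡ 1 + x^p
  fermat : ∀ x → x ^ p ≡[ p ] x
  fermat zero    = ≡⇒mod 0^p≡0
  fermat (suc x) with prime-binomial p-prime x
  ... | M , expansion = begin
    (1 + x) ^ p                                ≡⟨ expansion ⟩
    1 + p * x + p * (x * x * M) + x ^ p        ≡⟨ regroup p x M (x ^ p) ⟩
    (1 + x ^ p) + (x + x * x * M) * p          ≈⟨ +-multiple-mod (1 + x ^ p) (x + x * x * M) ⟩
    1 + x ^ p                                  ≈⟨ +-mod (mod-refl {a = 1}) (fermat x) ⟩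
    1 + x                                      ∎
    where
    open ModReasoning p
    regroup : ∀ p x M y → 1 + p * x + p * (x * x * M) + y ≡ (1 + y) + (x + x * x * M) * p
    regroup = solve-∀

  p∤1+p* : ∀ W → ¬ p ∣ 1 + p * W
  p∤1+p* W p∣1+pW = <⇒≢ 1<p (sym (∣1⇒≡1 (∣m+n∣m⇒∣n p∣pW+1 (m∣m*n W))))
    where
    p∣pW+1 : p ∣ p * W + 1
    p∣pW+1 = subst (p ∣_) (+-comm 1 (p * W)) p∣1+pW

  prime-power-cancel : ∀ k {d c} → ¬ p ∣ c → p ^ k ∣ d * c → p ^ k ∣ d
  prime-power-cancel zero    {d} _ _ = 1∣ d
  prime-power-cancel (suc k) {d} {c} p∤c p^[1+k]∣dc
    with euclidsLemma d c p-prime (∣-trans (m∣m*n (p ^ k)) p^[1+k]∣dc)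
  ... | inj₂ p∣c = ⊥-elim (p∤c p∣c)
  ... | inj₁ (divides e refl) =
    subst (p * p ^ k ∣_) (*-comm p e) (*-monoʳ-∣ p (prime-power-cancel k p∤c p^k∣ec))
    where
    p^k∣ec : p ^ k ∣ e * c
    p^k∣ec = *-cancelˡ-∣ p (subst (p * p ^ k ∣_) (reassociate e p c) p^[1+k]∣dc)
      where
      reassociate : ∀ e p c → e * p * c ≡ p * (e * c)
      reassociate = solve-∀

  module _ (3≤p : 3 ≤ p) where

    cube-split : ∀ d → d ^ p ≡ d * (d * (d * d ^ (p ∸ 3)))
    cube-split d = begin
      d ^ p                        ≡⟨ cong (d ^_) (m+[n∸m]≡n 3≤p) ⟨
      d ^ (3 + (p ∸ 3))            ≡⟨ ^-distribˡ-+-* d 3 (p ∸ 3) ⟩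
      d * (d * (d * 1)) * d ^ (p ∸ 3) ≡⟨ regroup d (d ^ (p ∸ 3)) ⟩
      d * (d * (d * d ^ (p ∸ 3)))  ∎
      where
      open ≡-Reasoning
      regroup : ∀ d y → d * (d * (d * 1)) * y ≡ d * (d * (d * y))
      regroup = solve-∀

    odd-prime-binomial : ∀ e → ∃[ W ] (1 + e * p) ^ p ≡ 1 + p * (e * p * (1 + p * W))
    odd-prime-binomial e with prime-binomial p-prime (e * p)
    ... | M , expansion = e * M + e * e * d ^ (p ∸ 3) , (begin
      (1 + d) ^ p                                  ≡⟨ expansion ⟩
      1 + p * d + p * (d * d * M) + d ^ p           ≡⟨ cong (1 + p * d + p * (d * d * M) +_) (cube-split d) ⟩
      1 + p * d + p * (d * d * M) + d * (d * (d * d ^ (p ∸ 3)))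
        ≡⟨ regroup e p M (d ^ (p ∸ 3)) ⟩
      1 + p * (d * (1 + p * (e * M + e * e * d ^ (p ∸ 3)))) ∎)
      where
      open ≡-Reasoning
      d = e * p
      regroup : ∀ e p M y →
        1 + p * (e * p) + p * (e * p * (e * p) * M) + e * p * (e * p * (e * p * y))
          ≡ 1 + p * (e * p * (1 + p * (e * M + e * e * y)))
      regroup = solve-∀

    root-of-unity-mod-p : ∀ k μ → μ ^ p ≡[p^ suc k ] 1 → μ ≡[ p ] 1
    root-of-unity-mod-p k μ μ^p≡1 = mod-trans (mod-sym (fermat μ)) (mod-∣ (m∣m*n (p ^ k)) μ^p≡1)
      where
      instance
        p^[1+k]≢0 : NonZero (p ^ suc k)
        p^[1+k]≢0 = m^n≢0 p (suc k)

    root-of-unity-descent : ∀ k μ → μ ^ p ≡[p^ suc k ] 1 → μ ≡[p^ k ] 1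
    root-of-unity-descent k zero 0^p≡1 =
      contradiction (mod⇒≡ (<-trans z<s 1<p) 1<p (root-of-unity-mod-p k 0 0^p≡1)) λ ()
    root-of-unity-descent k (suc d) μ^p≡1
      with +-mod-self⇒∣ 1 d (root-of-unity-mod-p k (suc d) μ^p≡1)
    ... | divides e refl with odd-prime-binomial e
    ... | W , expansion = ∣⇒+-mod-self 1 p^k∣d
      where
      instance
        p^k≢0 : NonZero (p ^ k)
        p^k≢0 = m^n≢0 p k
        p^[1+k]≢0 : NonZero (p ^ suc k)
        p^[1+k]≢0 = m^n≢0 p (suc k)
      p^[1+k]∣pd[1+pW] : p * p ^ k ∣ p * (e * p * (1 + p * W))
      p^[1+k]∣pd[1+pW] = +-mod-self⇒∣ 1 _ (mod-trans (≡⇒mod (sym expansion)) μ^p≡1)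
      p^k∣d : p ^ k ∣ e * p
      p^k∣d = prime-power-cancel k (p∤1+p* W) (*-cancelˡ-∣ p p^[1+k]∣pd[1+pW])

    power-descent : ∀ m n λ' → λ' ^ (p ^ suc n) ≡[p^ suc m ] 1 → λ' ^ (p ^ n) ≡[p^ m ] 1
    power-descent m n λ' λ'^p^[1+n]≡1 = root-of-unity-descent m (λ' ^ (p ^ n))
      (subst (λ x → x ≡[p^ suc m ] 1) (sym λ'^[p^n]^p≡λ'^p^[1+n]) λ'^p^[1+n]≡1)
      where
      λ'^[p^n]^p≡λ'^p^[1+n] : (λ' ^ (p ^ n)) ^ p ≡ λ' ^ (p ^ suc n)
      λ'^[p^n]^p≡λ'^p^[1+n] = trans (^-*-assoc λ' (p ^ n) p) (cong (λ' ^_) (*-comm (p ^ n) p))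

module PresentedGroup (p m n λ' : ℕ) where

  infix 4 _≈_
  _≈_ : Word → Word → Set
  _≈_ = GEq p m n λ'

  group : Group 0ℓ 0ℓ
  group = record
    { Carrier = Word ; _≈_ = _≈_ ; _∙_ = _·_ ; ε = one ; _⁻¹ = inv
    ; isGroup = record
      { isMonoid = record
        { isSemigroup = record
          { isMagma = record
            { isEquivalence = record { refl = ≈refl ; sym = ≈sym ; trans = ≈trans }
            ; ∙-cong = ·-cong }
          ; assoc = assoc }
        ; identity = idˡ , idʳ }
      ; inverse = invˡ , invʳ
      ; ⁻¹-cong = inv-cong } }

  open Group group public using (setoid; ∙-congˡ; ∙-congʳ) renaming (reflexive to ≡⇒≈)
  open GroupProperties group public using (\\-leftDividesˡ; \\-leftDividesʳ)
  open GroupProperties group using (inverseʳ-unique; ⁻¹-anti-homo-∙; ⁻¹-involutive)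
  open SetoidReasoning setoid

  comm⇒commute : ∀ a b → comm a b ≈ one → a · b ≈ b · a
  comm⇒commute a b [a,b]≈1 = begin
    a · b                  ≈⟨ inverseʳ-unique (inv a · inv b) (a · b) a⁻¹b⁻¹ab≈1 ⟩
    inv (inv a · inv b)    ≈⟨ ⁻¹-anti-homo-∙ (inv a) (inv b) ⟩
    inv (inv b) · inv (inv a) ≈⟨ ·-cong (⁻¹-involutive b) (⁻¹-involutive a) ⟩
    b · a                  ∎
    where
    a⁻¹b⁻¹ab≈1 : (inv a · inv b) · (a · b) ≈ one
    a⁻¹b⁻¹ab≈1 = ≈trans (≈sym (assoc (inv a · inv b) a b)) [a,b]≈1

  pow-+ : ∀ g i j → pow g (i + j) ≈ pow g i · pow g j
  pow-+ g zero    j = ≈sym (idˡ _)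
  pow-+ g (suc i) j = ≈trans (∙-congˡ (pow-+ g i j)) (≈sym (assoc g _ _))

  pow-* : ∀ g i j → pow g (i * j) ≈ pow (pow g j) i
  pow-* g zero    j = ≈refl
  pow-* g (suc i) j = ≈trans (pow-+ g j (i * j)) (∙-congˡ (pow-* g i j))

  pow-one : ∀ k → pow one k ≈ one
  pow-one zero    = ≈refl
  pow-one (suc k) = ≈trans (idˡ _) (pow-one k)

  pow-cong : ∀ k {a b} → a ≈ b → pow a k ≈ pow b k
  pow-cong zero    a≈b = ≈refl
  pow-cong (suc k) a≈b = ·-cong a≈b (pow-cong k a≈b)

  pow-mod : ∀ g {N} .{{_ : NonZero N}} → pow g N ≈ one → ∀ {k k'} → k ≡[ N ] k' → pow g k ≈ pow g k'
  pow-mod g {N} g^N≈1 {k} {k'} (mod k%N≡k'%N) = begin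
    pow g k                          ≡⟨ cong (pow g) (m≡m%n+[m/n]*n k N) ⟩
    pow g (k % N + k / N * N)        ≈⟨ reduce k ⟩
    pow g (k % N)                    ≡⟨ cong (pow g) k%N≡k'%N ⟩
    pow g (k' % N)                   ≈⟨ reduce k' ⟨
    pow g (k' % N + k' / N * N)      ≡⟨ cong (pow g) (m≡m%n+[m/n]*n k' N) ⟨
    pow g k'                         ∎
    where
    reduce : ∀ k → pow g (k % N + k / N * N) ≈ pow g (k % N)
    reduce k = begin
      pow g (k % N + k / N * N)           ≈⟨ pow-+ g (k % N) (k / N * N) ⟩
      pow g (k % N) · pow g (k / N * N)   ≈⟨ ∙-congˡ (pow-* g (k / N) N) ⟩
      pow g (k % N) · pow (pow g N) (k / N) ≈⟨ ∙-congˡ (pow-cong (k / N) g^N≈1) ⟩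
      pow g (k % N) · pow one (k / N)     ≈⟨ ∙-congˡ (pow-one (k / N)) ⟩
      pow g (k % N) · one                 ≈⟨ idʳ _ ⟩
      pow g (k % N)                       ∎

  shift-pow : ∀ {a g b} → a · g ≈ g · b → ∀ k → pow a k · g ≈ g · pow b k
  shift-pow {a} {g} {b} ag≈gb zero = ≈trans (idˡ g) (≈sym (idʳ g))
  shift-pow {a} {g} {b} ag≈gb (suc k) = begin
    (a · pow a k) · g     ≈⟨ assoc a _ g ⟩
    a · (pow a k · g)     ≈⟨ ∙-congˡ (shift-pow ag≈gb k) ⟩
    a · (g · pow b k)     ≈⟨ assoc a g _ ⟨
    (a · g) · pow b k     ≈⟨ ∙-congʳ ag≈gb ⟩
    (g · b) · pow b k     ≈⟨ assoc g b _ ⟩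
    g · (b · pow b k)     ∎

  inv-left⇔ : ∀ {a s b} → b ≈ inv s · a ⇔ a ≈ s · b
  inv-left⇔ {a} {s} {b} = mk⇔
    (λ b≈s⁻¹a → ≈trans (≈sym (\\-leftDividesˡ s a)) (∙-congˡ (≈sym b≈s⁻¹a)))
    (λ a≈sb → ≈trans (≈sym (\\-leftDividesʳ s b)) (∙-congˡ (≈sym a≈sb)))

module Isomorphism (p m₁ n λ' : ℕ) .{{_ : NonZero p}}
                   .{{_ : NonZero (p ^ m₁)}} .{{_ : NonZero (p ^ n)}}
                   (λ'-period : λ' ^ (p ^ n) ≡[ p ^ m₁ ] 1) where

  open PresentedGroup p (suc m₁) n λ'

  P₁ Pₙ : ℕ
  P₁ = p ^ m₁
  Pₙ = p ^ n

  instance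
    pP₁≢0 : NonZero (p * P₁)
    pP₁≢0 = m*n≢0 p P₁

  λ'-periodic : ∀ {b b'} → b ≡[ Pₙ ] b' → λ' ^ b ≡[ P₁ ] λ' ^ b'
  λ'-periodic {b} {b'} (mod b%≡b'%) = begin
    λ' ^ b           ≈⟨ reduce b ⟩
    λ' ^ (b % Pₙ)    ≡⟨ cong (λ' ^_) b%≡b'% ⟩
    λ' ^ (b' % Pₙ)   ≈⟨ reduce b' ⟨
    λ' ^ b'          ∎
    where
    open ModReasoning P₁
    reduce : ∀ b → λ' ^ b ≡[ P₁ ] λ' ^ (b % Pₙ)
    reduce b = begin
      λ' ^ b                                  ≡⟨ cong (λ' ^_) (m≡m%n+[m/n]*n b Pₙ) ⟩
      λ' ^ (b % Pₙ + b / Pₙ * Pₙ)             ≡⟨ ^-distribˡ-+-* λ' (b % Pₙ) (b / Pₙ * Pₙ) ⟩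
      λ' ^ (b % Pₙ) * λ' ^ (b / Pₙ * Pₙ)      ≡⟨ cong (λ e → λ' ^ (b % Pₙ) * λ' ^ e) (*-comm (b / Pₙ) Pₙ) ⟩
      λ' ^ (b % Pₙ) * λ' ^ (Pₙ * (b / Pₙ))    ≡⟨ cong (λ' ^ (b % Pₙ) *_) (^-*-assoc λ' Pₙ (b / Pₙ)) ⟨
      λ' ^ (b % Pₙ) * (λ' ^ Pₙ) ^ (b / Pₙ)    ≈⟨ *-mod (mod-refl {a = λ' ^ (b % Pₙ)}) (^-mod (b / Pₙ) λ'-period) ⟩
      λ' ^ (b % Pₙ) * 1 ^ (b / Pₙ)            ≡⟨ cong (λ' ^ (b % Pₙ) *_) (^-zeroˡ (b / Pₙ)) ⟩
      λ' ^ (b % Pₙ) * 1                       ≡⟨ *-identityʳ _ ⟩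
      λ' ^ (b % Pₙ)                           ∎

  -- Coordinates (b , a , c) stand for y^b x^a z^c; they are read modulo
  -- (p^n, p^m₁, p), i.e. up to the setoid below.
  Coords : Set
  Coords = ℕ × ℕ × ℕ

  coords-setoid : Setoid 0ℓ 0ℓ
  coords-setoid = ×-setoid (mod-setoid Pₙ) (×-setoid (mod-setoid P₁) (mod-setoid p))

  open Setoid coords-setoid public using ()
    renaming (_≈_ to _~_; refl to ~-refl; sym to ~-sym; trans to ~-trans; reflexive to ≡⇒~)

  origin : Coords
  origin = 0 , 0 , 0

  -- G acts on coordinates by left multiplication: x adds λ'^b to a, y adds 1
  -- to b, z adds 1 to c; the inverses subtract modulo the respective order.
  actGen actGen⁻¹ : Gen → Coords → Coords
  actGen gx (b , a , c) = b , λ' ^ b + a , c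
  actGen gy (b , a , c) = 1 + b , a , c
  actGen gz (b , a , c) = b , a , 1 + c
  actGen⁻¹ gx (b , a , c) = b , (P₁ ∸ 1) * λ' ^ b + a , c
  actGen⁻¹ gy (b , a , c) = (Pₙ ∸ 1) * 1 + b , a , c
  actGen⁻¹ gz (b , a , c) = b , a , (p ∸ 1) * 1 + c

  act act⁻¹ : Word → Coords → Coords
  act (gen g) = actGen g
  act one     = λ s → s
  act (u · v) = λ s → act u (act v s)
  act (inv u) = act⁻¹ u
  act⁻¹ (gen g) = actGen⁻¹ g
  act⁻¹ one     = λ s → s
  act⁻¹ (u · v) = λ s → act⁻¹ v (act⁻¹ u s)
  act⁻¹ (inv u) = act u

  -- the action respects ~ (for x this is where λ'^(p^n) ≡ 1 is used)
  actGen-cong : ∀ g {s t} → s ~ t → actGen g s ~ actGen g t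
  actGen-cong gx (b≡ , a≡ , c≡) = b≡ , +-mod (λ'-periodic b≡) a≡ , c≡
  actGen-cong gy (b≡ , a≡ , c≡) = +-mod mod-refl b≡ , a≡ , c≡
  actGen-cong gz (b≡ , a≡ , c≡) = b≡ , a≡ , +-mod mod-refl c≡

  actGen⁻¹-cong : ∀ g {s t} → s ~ t → actGen⁻¹ g s ~ actGen⁻¹ g t
  actGen⁻¹-cong gx (b≡ , a≡ , c≡) = b≡ , +-mod (*-mod (mod-refl {a = P₁ ∸ 1}) (λ'-periodic b≡)) a≡ , c≡
  actGen⁻¹-cong gy (b≡ , a≡ , c≡) = +-mod mod-refl b≡ , a≡ , c≡
  actGen⁻¹-cong gz (b≡ , a≡ , c≡) = b≡ , a≡ , +-mod mod-refl c≡

  act-cong : ∀ u {s t} → s ~ t → act u s ~ act u t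
  act⁻¹-cong : ∀ u {s t} → s ~ t → act⁻¹ u s ~ act⁻¹ u t
  act-cong (gen g) = actGen-cong g
  act-cong one     = λ s~t → s~t
  act-cong (u · v) = λ s~t → act-cong u (act-cong v s~t)
  act-cong (inv u) = act⁻¹-cong u
  act⁻¹-cong (gen g) = actGen⁻¹-cong g
  act⁻¹-cong one     = λ s~t → s~t
  act⁻¹-cong (u · v) = λ s~t → act⁻¹-cong v (act⁻¹-cong u s~t)
  act⁻¹-cong (inv u) = act-cong u

  actGen⁻¹-actGen : ∀ g s → actGen⁻¹ g (actGen g s) ~ s
  actGen⁻¹-actGen gx (b , a , c) = mod-refl , translate-inverseʳ (λ' ^ b) a , mod-refl
  actGen⁻¹-actGen gy (b , a , c) = translate-inverseʳ 1 b , mod-refl , mod-refl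
  actGen⁻¹-actGen gz (b , a , c) = mod-refl , mod-refl , translate-inverseʳ 1 c

  actGen-actGen⁻¹ : ∀ g s → actGen g (actGen⁻¹ g s) ~ s
  actGen-actGen⁻¹ gx (b , a , c) = mod-refl , translate-inverseˡ (λ' ^ b) a , mod-refl
  actGen-actGen⁻¹ gy (b , a , c) = translate-inverseˡ 1 b , mod-refl , mod-refl
  actGen-actGen⁻¹ gz (b , a , c) = mod-refl , mod-refl , translate-inverseˡ 1 c

  act⁻¹-act : ∀ u s → act⁻¹ u (act u s) ~ s
  act-act⁻¹ : ∀ u s → act u (act⁻¹ u s) ~ s
  act⁻¹-act (gen g) s = actGen⁻¹-actGen g s
  act⁻¹-act one     s = ~-refl
  act⁻¹-act (u · v) s = ~-trans (act⁻¹-cong v (act⁻¹-act u (act v s))) (act⁻¹-act v s)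
  act⁻¹-act (inv u) s = act-act⁻¹ u s
  act-act⁻¹ (gen g) s = actGen-actGen⁻¹ g s
  act-act⁻¹ one     s = ~-refl
  act-act⁻¹ (u · v) s = ~-trans (act-cong u (act-act⁻¹ v (act⁻¹ u s))) (act-act⁻¹ u s)
  act-act⁻¹ (inv u) s = act⁻¹-act u s

  act-pow-X : ∀ k b a c → act (pow X k) (b , a , c) ≡ (b , k * λ' ^ b + a , c)
  act-pow-X zero    b a c = refl
  act-pow-X (suc k) b a c =
    trans (cong (actGen gx) (act-pow-X k b a c)) (cong (λ a' → b , a' , c) (sym (+-assoc (λ' ^ b) (k * λ' ^ b) a)))

  act-pow-Y : ∀ k b a c → act (pow Y k) (b , a , c) ≡ (k + b , a , c)
  act-pow-Y zero    b a c = refl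
  act-pow-Y (suc k) b a c = cong (actGen gy) (act-pow-Y k b a c)

  act-pow-Z : ∀ k b a c → act (pow Z k) (b , a , c) ≡ (b , a , k + c)
  act-pow-Z zero    b a c = refl
  act-pow-Z (suc k) b a c = cong (actGen gz) (act-pow-Z k b a c)

  sound : ∀ {u v} → u ≈ v → ∀ s → act u s ~ act v s
  sound ≈refl         s = ~-refl
  sound (≈sym u≈v)    s = ~-sym (sound u≈v s)
  sound (≈trans u≈v v≈w) s = ~-trans (sound u≈v s) (sound v≈w s)
  sound (·-cong {a} {b} {c} {d} a≈b c≈d) s = ~-trans (act-cong a (sound c≈d s)) (sound a≈b (act d s))
  sound (inv-cong {a} {b} a≈b) s = begin
    act⁻¹ a s                        ≈⟨ act⁻¹-cong a (act-act⁻¹ b s) ⟨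
    act⁻¹ a (act b (act⁻¹ b s))      ≈⟨ act⁻¹-cong a (sound a≈b (act⁻¹ b s)) ⟨
    act⁻¹ a (act a (act⁻¹ b s))      ≈⟨ act⁻¹-act a (act⁻¹ b s) ⟩
    act⁻¹ b s                        ∎
    where open SetoidReasoning coords-setoid
  sound (assoc _ _ _) s = ~-refl
  sound (idˡ _)       s = ~-refl
  sound (idʳ _)       s = ~-refl
  sound (invˡ u)      s = act⁻¹-act u s
  sound (invʳ u)      s = act-act⁻¹ u s
  sound relX  (b , a , c) rewrite act-pow-X P₁ b a c =
    mod-refl , mod-trans (≡⇒mod (trans (cong (_+ a) (*-comm P₁ (λ' ^ b))) (+-comm _ a))) (+-multiple-mod a (λ' ^ b)) , mod-refl
  sound relY  (b , a , c) rewrite act-pow-Y Pₙ b a c =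
    mod (trans (cong (_% Pₙ) (+-comm Pₙ b)) ([m+n]%n≡m%n b Pₙ)) , mod-refl , mod-refl
  sound relZ  (b , a , c) rewrite act-pow-Z p b a c =
    mod-refl , mod-refl , mod (trans (cong (_% p) (+-comm p c)) ([m+n]%n≡m%n c p))
  sound relYX (b , a , c) rewrite act-pow-X λ' b a c = translate-inverseʳ 1 b , mod-refl , mod-refl
  sound relZX (b , a , c) = mod-refl , translate-inverseʳ (λ' ^ b) a , translate-inverseʳ 1 c
  sound relZY (b , a , c) = translate-inverseʳ 1 b , mod-refl , translate-inverseʳ 1 c

  nf : Coords → Word
  nf (b , a , c) = pow Y b · (pow X a · pow Z c)

  nf-cong : ∀ {s t} → s ~ t → nf s ≈ nf t
  nf-cong (b≡ , a≡ , c≡) = ·-cong (pow-mod Y relY b≡) (·-cong (pow-mod X relX a≡) (pow-mod Z relZ c≡))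

  act-nf : ∀ t → act (nf t) origin ~ t
  act-nf (b , a , c)
    rewrite act-pow-Z c 0 0 0 | act-pow-X a 0 0 (c + 0) | act-pow-Y b 0 (a * 1 + 0) (c + 0) =
    ≡⇒mod (+-identityʳ b) , ≡⇒mod (trans (+-identityʳ (a * 1)) (*-identityʳ a)) , ≡⇒mod (+-identityʳ c)

  X·Y : X · Y ≈ Y · pow X λ'
  X·Y = begin
    X · Y                  ≈⟨ \\-leftDividesˡ Y (X · Y) ⟨
    Y · (inv Y · (X · Y))  ≈⟨ ∙-congˡ (≈sym (assoc (inv Y) X Y)) ⟩
    Y · (inv Y · X · Y)    ≈⟨ ∙-congˡ relYX ⟩
    Y · pow X λ'           ∎
    where open SetoidReasoning setoid

  X^k·Y^b : ∀ k b → pow X k · pow Y b ≈ pow Y b · pow X (k * λ' ^ b)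
  X^k·Y^b k zero = begin
    pow X k · one          ≈⟨ idʳ _ ⟩
    pow X k                ≡⟨ cong (pow X) (*-identityʳ k) ⟨
    pow X (k * 1)          ≈⟨ idˡ _ ⟨
    one · pow X (k * 1)    ∎
    where open SetoidReasoning setoid
  X^k·Y^b k (suc b) = begin
    pow X k · (Y · pow Y b)                   ≈⟨ assoc _ Y _ ⟨
    (pow X k · Y) · pow Y b                   ≈⟨ ∙-congʳ X^k·Y ⟩
    (Y · pow X (k * λ')) · pow Y b            ≈⟨ assoc Y _ _ ⟩
    Y · (pow X (k * λ') · pow Y b)            ≈⟨ ∙-congˡ (X^k·Y^b (k * λ') b) ⟩
    Y · (pow Y b · pow X (k * λ' * λ' ^ b))   ≈⟨ assoc Y _ _ ⟨
    (Y · pow Y b) · pow X (k * λ' * λ' ^ b)   ≡⟨ cong (λ e → (Y · pow Y b) · pow X e) (*-assoc k λ' (λ' ^ b)) ⟩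
    (Y · pow Y b) · pow X (k * λ' ^ suc b)    ∎
    where
    open SetoidReasoning setoid
    X^k·Y : pow X k · Y ≈ Y · pow X (k * λ')
    X^k·Y = ≈trans (shift-pow X·Y k) (∙-congˡ (≈sym (pow-* X k λ')))

  Z·Y^b : ∀ b → Z · pow Y b ≈ pow Y b · Z
  Z·Y^b b = ≈sym (shift-pow (≈sym (comm⇒commute Z Y relZY)) b)

  Z·X^a : ∀ a → Z · pow X a ≈ pow X a · Z
  Z·X^a a = ≈sym (shift-pow (≈sym (comm⇒commute Z X relZX)) a)

  actGen-nf : ∀ g t → gen g · nf t ≈ nf (actGen g t)
  actGen-nf gx (b , a , c) = begin
    X · (pow Y b · (pow X a · pow Z c))                ≈⟨ assoc X _ _ ⟨
    (X · pow Y b) · (pow X a · pow Z c)                ≈⟨ ∙-congʳ X·Y^b ⟩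
    (pow Y b · pow X (λ' ^ b)) · (pow X a · pow Z c)   ≈⟨ assoc _ _ _ ⟩
    pow Y b · (pow X (λ' ^ b) · (pow X a · pow Z c))   ≈⟨ ∙-congˡ (assoc _ _ _) ⟨
    pow Y b · ((pow X (λ' ^ b) · pow X a) · pow Z c)   ≈⟨ ∙-congˡ (∙-congʳ (pow-+ X (λ' ^ b) a)) ⟨
    pow Y b · (pow X (λ' ^ b + a) · pow Z c)           ∎
    where
    open SetoidReasoning setoid
    X·Y^b : X · pow Y b ≈ pow Y b · pow X (λ' ^ b)
    X·Y^b = ≈trans (∙-congʳ (≈sym (idʳ X)))
              (≈trans (X^k·Y^b 1 b) (∙-congˡ (≡⇒≈ (cong (pow X) (*-identityˡ (λ' ^ b))))))
  actGen-nf gy (b , a , c) = ≈sym (assoc Y (pow Y b) _)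
  actGen-nf gz (b , a , c) = begin
    Z · (pow Y b · (pow X a · pow Z c))     ≈⟨ assoc Z _ _ ⟨
    (Z · pow Y b) · (pow X a · pow Z c)     ≈⟨ ∙-congʳ (Z·Y^b b) ⟩
    (pow Y b · Z) · (pow X a · pow Z c)     ≈⟨ assoc _ Z _ ⟩
    pow Y b · (Z · (pow X a · pow Z c))     ≈⟨ ∙-congˡ (assoc Z _ _) ⟨
    pow Y b · ((Z · pow X a) · pow Z c)     ≈⟨ ∙-congˡ (∙-congʳ (Z·X^a a)) ⟩
    pow Y b · ((pow X a · Z) · pow Z c)     ≈⟨ ∙-congˡ (assoc _ Z _) ⟩
    pow Y b · (pow X a · (Z · pow Z c))     ∎
    where open SetoidReasoning setoid

  act-nf-left : ∀ w t → w · nf t ≈ nf (act w t)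
  act-nf-left (gen g) t = actGen-nf g t
  act-nf-left one     t = idˡ (nf t)
  act-nf-left (u · v) t =
    ≈trans (assoc u v (nf t)) (≈trans (∙-congˡ (act-nf-left v t)) (act-nf-left u (act v t)))
  act-nf-left (inv u) t = ≈sym (begin
    nf (act⁻¹ u t)                          ≈⟨ \\-leftDividesʳ u (nf (act⁻¹ u t)) ⟨
    inv u · (u · nf (act⁻¹ u t))            ≈⟨ ∙-congˡ (act-nf-left u (act⁻¹ u t)) ⟩
    inv u · nf (act u (act⁻¹ u t))          ≈⟨ ∙-congˡ (nf-cong (act-act⁻¹ u t)) ⟩
    inv u · nf t                            ∎)
    where open SetoidReasoning setoid

  normal-form : ∀ g → g ≈ nf (act g origin)
  normal-form g = begin
    g                 ≈⟨ idʳ g ⟨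
    g · one           ≈⟨ ∙-congˡ (≈trans (idˡ _) (idˡ one)) ⟨
    g · nf origin     ≈⟨ act-nf-left g origin ⟩
    nf (act g origin) ∎
    where open SetoidReasoning setoid

  nf-injective : ∀ {s t} → nf s ≈ nf t → s ~ t
  nf-injective {s} {t} nf-s≈nf-t = ~-trans (~-sym (act-nf s)) (~-trans (sound nf-s≈nf-t origin) (act-nf t))

  digits-injective : ∀ {j j'} → j < p * P₁ → j' < p * P₁ →
    j % P₁ ≡[ P₁ ] j' % P₁ → j / P₁ ≡[ p ] j' / P₁ → j ≡ j'
  digits-injective {j} {j'} j<pP₁ j'<pP₁ low≡ high≡ = begin
    j                        ≡⟨ m≡m%n+[m/n]*n j P₁ ⟩
    j % P₁ + j / P₁ * P₁     ≡⟨ cong₂ (λ a c → a + c * P₁) low high ⟩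
    j' % P₁ + j' / P₁ * P₁   ≡⟨ m≡m%n+[m/n]*n j' P₁ ⟨
    j'                       ∎
    where
    open ≡-Reasoning
    low  = mod⇒≡ (m%n<n j P₁) (m%n<n j' P₁) low≡
    high = mod⇒≡ (m<n*o⇒m/o<n j<pP₁) (m<n*o⇒m/o<n j'<pP₁) high≡

  digits-join : ∀ {a c} → a < P₁ → c < p → a + c * P₁ < p * P₁
  digits-join {a} {c} a<P₁ c<p = <-≤-trans (+-monoˡ-< (c * P₁) a<P₁) (*-monoˡ-≤ P₁ c<p)

  digits-join-/ : ∀ {a} c → a < P₁ → (a + c * P₁) / P₁ ≡ c
  digits-join-/ {a} c a<P₁ = begin
    (a + c * P₁) / P₁        ≡⟨ +-distrib-/-∣ʳ a (n∣m*n c) ⟩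
    a / P₁ + c * P₁ / P₁     ≡⟨ cong₂ _+_ (m<n⇒m/n≡0 a<P₁) (m*n/n≡m c P₁) ⟩
    c                        ∎
    where open ≡-Reasoning

  Vertex : Set
  Vertex = MPVertex p (suc m₁) n

  coords : Vertex → Coords
  coords (j , i) = toℕ i , toℕ j % P₁ , toℕ j / P₁

  φ : Vertex → Word
  φ u = nf (coords u)

  coords-injective : ∀ u v → coords u ~ coords v → u ≡ v
  coords-injective (j , i) (j' , i') (i≡ , low≡ , high≡) = cong₂ _,_
    (toℕ-injective (digits-injective (toℕ<n j) (toℕ<n j') low≡ high≡))
    (toℕ-injective (mod⇒≡ (toℕ<n i) (toℕ<n i') i≡))

  coords-surjective : ∀ t → ∃[ u ] coords u ~ t
  coords-surjective (b , a , c) = (j , i) , i≡b , j%P₁≡a , j/P₁≡c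
    where
    j<pP₁ = digits-join (m%n<n a P₁) (m%n<n c p)
    j : Fin (p * P₁)
    j = fromℕ< j<pP₁
    i : Fin Pₙ
    i = fromℕ< (m%n<n b Pₙ)
    i≡b : toℕ i ≡[ Pₙ ] b
    i≡b = ≡%⇒mod (toℕ-fromℕ< (m%n<n b Pₙ))
    j%P₁≡a : toℕ j % P₁ ≡[ P₁ ] a
    j%P₁≡a = mod-trans (%-mod (toℕ j)) (mod-trans (≡⇒mod (toℕ-fromℕ< j<pP₁))
               (mod-trans (+-multiple-mod (a % P₁) (c % p)) (%-mod a)))
    j/P₁≡c : toℕ j / P₁ ≡[ p ] c
    j/P₁≡c = ≡%⇒mod (trans (cong (_/ P₁) (toℕ-fromℕ< j<pP₁)) (digits-join-/ (c % p) (m%n<n a P₁)))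

  φ-injective : ∀ u v → φ u ≈ φ v → u ≡ v
  φ-injective u v φu≈φv = coords-injective u v (nf-injective φu≈φv)

  φ-surjective : ∀ g → ∃[ u ] φ u ≈ g
  φ-surjective g with coords-surjective (act g origin)
  ... | u , coords-u~ = u , ≈trans (nf-cong coords-u~) (≈sym (normal-form g))

  φ-arc⇔ : ∀ w u v → φ v ≈ w · φ u ⇔ coords v ~ act w (coords u)
  φ-arc⇔ w u v = mk⇔
    (λ φv≈wφu → nf-injective (≈trans φv≈wφu (act-nf-left w (coords u))))
    (λ coords-v~ → ≈trans (nf-cong coords-v~) (≈sym (act-nf-left w (coords u))))

  LayerArc UpArc : Vertex → Vertex → Set
  LayerArc (j , i) (j' , i') = toℕ i ≡ toℕ i' ×
    ∃[ k ] k < p × toℕ j' ≡ (toℕ j + (k * P₁ + λ' ^ toℕ i)) % (p * P₁)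
  UpArc (j , i) (j' , i') = toℕ j ≡ toℕ j' × toℕ i' ≡ (toℕ i + 1) % Pₙ

  XZArc YArc : Vertex → Vertex → Set
  XZArc u v = ∃[ k ] k < p × φ v ≈ (X · pow Z k) · φ u
  YArc u v = φ v ≈ Y · φ u

  act-XZ^k : ∀ k b a c → act (X · pow Z k) (b , a , c) ≡ (b , λ' ^ b + a , k + c)
  act-XZ^k k b a c = cong (actGen gx) (act-pow-Z k b a c)

  -- An arc inside a layer moves j by λ'^i modulo p^m₁ and leaves the
  -- digit j div p^m₁ free; so does multiplication by some x z^k.
  layer-arc⇔ : ∀ u v → LayerArc u v ⇔ XZArc u v
  layer-arc⇔ (j , i) (j' , i') = mk⇔ to from
    where
    t = λ' ^ toℕ i
    to : LayerArc (j , i) (j' , i') → XZArc (j , i) (j' , i')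
    to (i≡i' , shift) with residue-difference {p} (toℕ j' / P₁) (toℕ j / P₁)
    ... | k , k<p , high≡ = k , k<p , Equivalence.from (φ-arc⇔ (X · pow Z k) (j , i) (j' , i'))
          (~-trans (≡⇒mod (sym i≡i') , low≡ , high≡) (≡⇒~ (sym (act-XZ^k k _ _ _))))
      where
      low≡ : toℕ j' % P₁ ≡[ P₁ ] t + toℕ j % P₁
      low≡ = mod-trans (%-mod (toℕ j')) (mod-trans (Equivalence.to (refine⇔ {y = toℕ j} {t = t} (toℕ<n j')) shift)
               (+-mod (mod-refl {a = t}) (mod-sym (%-mod (toℕ j)))))
    from : XZArc (j , i) (j' , i') → LayerArc (j , i) (j' , i')
    from (k , k<p , φv≈) with ~-trans (Equivalence.to (φ-arc⇔ (X · pow Z k) (j , i) (j' , i')) φv≈)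
                                       (≡⇒~ (act-XZ^k k _ _ _))
    ... | i'≡i , low≡ , _ = sym (mod⇒≡ (toℕ<n i') (toℕ<n i) i'≡i) ,
          Equivalence.from (refine⇔ {y = toℕ j} {t = t} (toℕ<n j'))
            (mod-trans (mod-sym (%-mod (toℕ j'))) (mod-trans low≡ (+-mod (mod-refl {a = t}) (%-mod (toℕ j)))))

  up-arc⇔ : ∀ u v → UpArc u v ⇔ YArc u v
  up-arc⇔ (j , i) (j' , i') = mk⇔ to from
    where
    to : UpArc (j , i) (j' , i') → YArc (j , i) (j' , i')
    to (j≡j' , i'≡) = Equivalence.from (φ-arc⇔ Y (j , i) (j' , i'))
      ( ≡%⇒mod (trans i'≡ (cong (_% Pₙ) (+-comm (toℕ i) 1)))
      , ≡⇒mod (cong (_% P₁) (sym j≡j'))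
      , ≡⇒mod (cong (_/ P₁) (sym j≡j')))
    from : YArc (j , i) (j' , i') → UpArc (j , i) (j' , i')
    from φv≈ with Equivalence.to (φ-arc⇔ Y (j , i) (j' , i')) φv≈
    ... | i'≡ , low≡ , high≡ = sym (digits-injective (toℕ<n j') (toℕ<n j) low≡ high≡) ,
          trans (mod⇒≡% (toℕ<n i') i'≡) (cong (_% Pₙ) (+-comm 1 (toℕ i)))

  mp-adjacency : ∀ u v → MPAdj p (suc m₁) n λ' u v ⇔
    ((LayerArc u v ⊎ LayerArc v u) ⊎ (UpArc u v ⊎ UpArc v u))
  mp-adjacency (j , i) (j' , i') = mk⇔ to from
    where
    to : MPAdj p (suc m₁) n λ' (j , i) (j' , i') →
         (LayerArc (j , i) (j' , i') ⊎ LayerArc (j' , i') (j , i)) ⊎ (UpArc (j , i) (j' , i') ⊎ UpArc (j' , i') (j , i))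
    to (inj₁ (i≡i' , k , k<p , inj₁ j'≡)) = inj₁ (inj₁ (i≡i' , k , k<p , j'≡))
    to (inj₁ (i≡i' , k , k<p , inj₂ j≡))  =
      inj₁ (inj₂ (sym i≡i' , k , k<p , subst (λ l → toℕ j ≡ (toℕ j' + (k * P₁ + λ' ^ l)) % (p * P₁)) i≡i' j≡))
    to (inj₂ (j≡j' , inj₁ i'≡)) = inj₂ (inj₁ (j≡j' , i'≡))
    to (inj₂ (j≡j' , inj₂ i≡))  = inj₂ (inj₂ (sym j≡j' , i≡))
    from : (LayerArc (j , i) (j' , i') ⊎ LayerArc (j' , i') (j , i)) ⊎ (UpArc (j , i) (j' , i') ⊎ UpArc (j' , i') (j , i)) →
           MPAdj p (suc m₁) n λ' (j , i) (j' , i')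
    from (inj₁ (inj₁ (i≡i' , k , k<p , j'≡))) = inj₁ (i≡i' , k , k<p , inj₁ j'≡)
    from (inj₁ (inj₂ (i'≡i , k , k<p , j≡)))  =
      inj₁ (sym i'≡i , k , k<p , inj₂ (subst (λ l → toℕ j ≡ (toℕ j' + (k * P₁ + λ' ^ l)) % (p * P₁)) i'≡i j≡))
    from (inj₂ (inj₁ (j≡j' , i'≡))) = inj₂ (j≡j' , inj₁ i'≡)
    from (inj₂ (inj₂ (j'≡j , i≡)))  = inj₂ (sym j'≡j , inj₂ i≡)

  -- CayAdj, reorganised in the same way; an edge along s⁻¹ is an arc along s
  cayley-adjacency : ∀ u v → CayAdj p (suc m₁) n λ' (φ u) (φ v) ⇔
    ((XZArc u v ⊎ XZArc v u) ⊎ (YArc u v ⊎ YArc v u))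
  cayley-adjacency u v = mk⇔ to from
    where
    to : CayAdj p (suc m₁) n λ' (φ u) (φ v) → (XZArc u v ⊎ XZArc v u) ⊎ (YArc u v ⊎ YArc v u)
    to (_ , inj₁ (k , k<p , refl) , inj₁ φv≈) = inj₁ (inj₁ (k , k<p , φv≈))
    to (_ , inj₁ (k , k<p , refl) , inj₂ φv≈) = inj₁ (inj₂ (k , k<p , Equivalence.to inv-left⇔ φv≈))
    to (_ , inj₂ refl , inj₁ φv≈) = inj₂ (inj₁ φv≈)
    to (_ , inj₂ refl , inj₂ φv≈) = inj₂ (inj₂ (Equivalence.to inv-left⇔ φv≈))
    from : (XZArc u v ⊎ XZArc v u) ⊎ (YArc u v ⊎ YArc v u) → CayAdj p (suc m₁) n λ' (φ u) (φ v)
    from (inj₁ (inj₁ (k , k<p , φv≈))) = X · pow Z k , inj₁ (k , k<p , refl) , inj₁ φv≈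
    from (inj₁ (inj₂ (k , k<p , φu≈))) = X · pow Z k , inj₁ (k , k<p , refl) , inj₂ (Equivalence.from inv-left⇔ φu≈)
    from (inj₂ (inj₁ φv≈)) = Y , inj₂ refl , inj₁ φv≈
    from (inj₂ (inj₂ φu≈)) = Y , inj₂ refl , inj₂ (Equivalence.from inv-left⇔ φu≈)

  adjacency : ∀ u v → MPAdj p (suc m₁) n λ' u v ⇔ CayAdj p (suc m₁) n λ' (φ u) (φ v)
  adjacency u v = ⇔.trans (mp-adjacency u v) (⇔.trans
    ((layer-arc⇔ u v ⊎-⇔ layer-arc⇔ v u) ⊎-⇔ (up-arc⇔ u v ⊎-⇔ up-arc⇔ v u))
    (⇔.sym (cayley-adjacency u v)))

lemma6p3 : (p m n λ' : ℕ) → Prime p → ¬ (p ≡ 2) → 3 ≤ n + 2 → n + 2 ≤ m →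
    .{{_ : NonZero (p ^ m)}} .{{_ : NonZero (p ^ n)}} →
    λ' < p ^ m → Coprime λ' (p ^ m) → HasMultOrder λ' (p ^ m) (p ^ (n + 1)) →
    Σ (MPVertex p m n → Word) (λ f →
      (∀ u v → f u ≈⟨ p , m , n , λ' ⟩ f v → u ≡ v) ×
      (∀ g → Σ (MPVertex p m n) (λ u → f u ≈⟨ p , m , n , λ' ⟩ g)) ×
      (∀ u v → MPAdj p m n λ' u v ⇔ CayAdj p m n λ' (f u) (f v)))
-- m ≥ n + 2 ≥ 2, so m = m₁ + 1; p is an odd prime, so p ≥ 3; the order
-- hypothesis gives λ'^(p^(n+1)) ≡ 1 (mod p^m), hence λ'^(p^n) ≡ 1 (mod p^m₁),
-- which is all the isomorphism needs.
lemma6p3 p zero n λ' _ _ _ n+2≤0 = contradiction (≤-trans (m≤n+m 2 n) n+2≤0) λ ()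
lemma6p3 p (suc m₁) n λ' p-prime p≢2 _ _ _ _ (_ , λ'^p^[n+1]%≡ , _) =
  φ , φ-injective , φ-surjective , adjacency
  where
  open PrimePowers p-prime using (p≢0; 1<p; power-descent)
  instance
    p^m₁≢0 : NonZero (p ^ m₁)
    p^m₁≢0 = m^n≢0 p m₁
    p^n≢0 : NonZero (p ^ n)
    p^n≢0 = m^n≢0 p n
  3≤p : 3 ≤ p
  3≤p = ≤∧≢⇒< 1<p (λ 2≡p → p≢2 (sym 2≡p))
  λ'^p^[1+n]≡1 : λ' ^ (p ^ suc n) ≡[ p ^ suc m₁ ] 1
  λ'^p^[1+n]≡1 = mod (subst (λ e → (λ' ^ (p ^ e)) % (p ^ suc m₁) ≡ 1 % (p ^ suc m₁)) (+-comm n 1) λ'^p^[n+1]%≡)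
  open Isomorphism p m₁ n λ' (power-descent 3≤p m₁ n λ' λ'^p^[1+n]≡1)
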